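{- Let $(V,\mathcal{B})$ be a $(v,k,1)$-BIBD with well-distributed minimal sub-BIBDs with parameter $m$, whose minimal sub-BIBDs are $(v',k,1)$-BIBDs, and let $\mathcal{D}$ be the collection of minimal sub-BIBDs (viewed as point sets). Fix distinct $D_{1},D_{2}\in\mathcal{D}$ and let $i=|D_{1}\cap D_{2}|$ (so $i\in\{0,1,k\}$). For $D\in\mathcal{D}\setminus\{D_{1},D_{2}\}$ define $i_{1,D}=|D\cap(D_{1}\setminus D_{2})|$, $i_{2,D}=|D\cap D_{1}\cap D_{2}|$, $i_{3,D}=|D\cap(D_{2}\setminus D_{1})|$. Then, with all sums over $D\in\mathcal{D}\setminus\{D_{1},D_{2}\}$: $$\sum_{D}i_{1,D}=\sum_{D}i_{3,D}=(v'-i)\left(m\frac{v-1}{v'-1}-1\right),$$ $$\sum_{D}i_{1,D}^{2}=\sum_{D}i_{3,D}^{2}=(v'-i)\left(m\left(\frac{v-1}{v'-1}+v'-i-1\right)-v'+i\right),$$ $$\sum_{D}i_{2,D}=i\left(m\frac{v-1}{v'-1}-2\right),$$ $$\sum_{D}i_{1,D}i_{2,D}=\sum_{D}i_{2,D}i_{3,D}=i(v'-i)(m-1),$$ $$\sum_{D}i_{1,D}i_{3,D}=(v'-i)^{2}m.$$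
   Context: A $(v,k,\lambda)$-BIBD is a pair $(V,\mathcal{B})$ where $V$ is a finite set of $v$ points and $\mathcal{B}$ is a set (no repeated blocks) of $k$-subsets of $V$, $k>1$, such that every pair of distinct points lies in exactly $\lambda$ blocks; trivial cases are excluded. A sub-BIBD of a $(v,k,1)$-BIBD $(V,\mathcal{B})$ is a pair $(V',\mathcal{B}')$ with $V'\subseteq V$, $\mathcal{B}'\subseteq\{B\in\mathcal{B}:B\subseteq V'\}$, which is itself a $(v',k,1)$-BIBD. A sub-BIBD is minimal if $v'$ is minimal among all sub-BIBDs with $v'>k$. $(V,\mathcal{B})$ has well-distributed minimal sub-BIBDs if there are integers $l,m$ such that every point lies in exactly $l$ minimal sub-BIBDs and every block lies in exactly $m$ minimal sub-BIBDs. -}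

module Defs where

open import Data.Nat using (ℕ; _<_; _≤_)
open import Data.Bool using (Bool)
import Data.Bool as Bool
open import Data.Fin using (Fin)
open import Data.Fin.Subset using (Subset; _∈_; _⊆_; ∣_∣; ⊤)
open import Data.Fin.Subset.Properties using (_∈?_; _⊆?_)
open import Data.List using (List; length; filter; map)
open import Data.List.Membership.Propositional using () renaming (_∈_ to _∈ₗ_)
open import Data.List.Relation.Unary.Unique.Propositional using (Unique)
open import Data.Product using (Σ; _×_)
open import Data.Integer using (ℤ; _+_; +_)
open import Data.Vec.Properties using (≡-dec)
open import Relation.Binary.PropositionalEquality using (_≡_; _≢_)
open import Relation.Nullary using (¬_; Dec)
open import Relation.Nullary.Decidable using (_×-dec_; ¬?)

_≟ˢ_ : ∀ {n} (p q : Subset n) → Dec (p ≡ q)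
_≟ˢ_ = ≡-dec Bool._≟_

pairCount : ∀ {n} → Fin n → Fin n → List (Subset n) → ℕ
pairCount x y Bs = length (filter (λ B → (x ∈? B) ×-dec (y ∈? B)) Bs)

IsSteinerOn : ∀ {n} → ℕ → Subset n → List (Subset n) → Set
IsSteinerOn {n} k W Bs =
  Unique Bs ×
  ((B : Subset n) → B ∈ₗ Bs → (B ⊆ W) × (∣ B ∣ ≡ k)) ×
  ((x y : Fin n) → x ∈ W → y ∈ W → x ≢ y → pairCount x y Bs ≡ 1)

IsBIBD : (v k : ℕ) → List (Subset v) → Set
IsBIBD v k Bs = (1 < k) × (k < v) × IsSteinerOn k ⊤ Bs

IsSubBIBD : ∀ {v} → ℕ → List (Subset v) → Subset v → Set
IsSubBIBD {v} k Bs W =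
  Σ (List (Subset v)) λ Bs' →
    ((B : Subset v) → B ∈ₗ Bs' → (B ∈ₗ Bs) × (B ⊆ W)) × IsSteinerOn k W Bs'

IsMinimalSubBIBD : ∀ {v} → ℕ → List (Subset v) → Subset v → Set
IsMinimalSubBIBD {v} k Bs W =
  IsSubBIBD k Bs W × (k < ∣ W ∣) ×
  ((W' : Subset v) → IsSubBIBD k Bs W' → k < ∣ W' ∣ → ∣ W ∣ ≤ ∣ W' ∣)

pointDeg : ∀ {v} → List (Subset v) → Fin v → ℕ
pointDeg 𝒟 x = length (filter (x ∈?_) 𝒟)

blockDeg : ∀ {v} → List (Subset v) → Subset v → ℕ
blockDeg 𝒟 B = length (filter (B ⊆?_) 𝒟)

without₂ : ∀ {v} → List (Subset v) → Subset v → Subset v → List (Subset v)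
without₂ 𝒟 D₁ D₂ = filter (λ D → ¬? (D ≟ˢ D₁) ×-dec ¬? (D ≟ˢ D₂)) 𝒟

sumℤ : ∀ {A : Set} → (A → ℤ) → List A → ℤ
sumℤ f List.[] = + 0
sumℤ f (x List.∷ xs) = f x + sumℤ f xs

module Submission where

-- Each point lies in l members of 𝒟, and
-- two distinct points x, y lie in exactly m: a sub-design contains the block
-- through any two of its points, so the members through x and y are those
-- containing the unique block through x and y.  For any such balanced family,
-- double counting incidences gives, for arbitrary point sets P and Q,
--     Σ_D |D ∩ P| = l |P|,   Σ_D |D ∩ P| |D ∩ Q| = m |P| |Q| + (l - m) |P ∩ Q|,
-- and the choice P = {x}, Q = all points yields (v' - 1) l = m (v - 1).
-- Subtracting the terms for D₁ and D₂ and inserting the sizes of the Venn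
-- regions D₁ ─ D₂, D₁ ∩ D₂, D₂ ─ D₁ (and of their intersections with D₁, D₂
-- and with each other) gives the eight identities, stated multiplied by
-- v' - 1 where the paper divides by it.

open import Defs
open import Data.Nat using (ℕ; suc)
import Data.Nat as ℕ
import Data.Nat.Properties as ℕP
open import Data.Bool using (Bool; true; false; _∧_)
open import Data.Fin using (Fin; zero; suc; fromℕ<)
open import Data.Fin.Properties using (_≟_)
open import Data.Fin.Subset using (Subset; _∩_; _─_; ∣_∣; _∈_; _⊆_; ⊤; ⊥; ⁅_⁆)
open import Data.Fin.Subset.Properties
  using (_∈?_; _⊆?_; ∈⊤; ∩-assoc; ∩-comm; ∩-idem; ∩-identityʳ; ∣⊥∣≡0; ∣⁅x⁆∣≡1; ∣⊤∣≡n)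
open import Data.Vec using (lookup) renaming ([] to []ᵛ; _∷_ to _∷ᵛ_)
open import Data.Vec.Properties using (lookup-zipWith; []=⇒lookup; lookup⇒[]=)
open import Data.List using (List; []; _∷_; length; filter)
import Data.List.Properties as LP
open import Data.List.Relation.Unary.All as All using ()
open import Data.List.Relation.Unary.AllPairs using (_∷_)
open import Data.List.Relation.Unary.Unique.Propositional using (Unique)
import Data.List.Membership.Propositional.Properties as ∈ₗ
open import Data.List.Relation.Unary.Any using (here; there)
open import Data.List.Membership.Propositional using () renaming (_∈_ to _∈ₗ_)
open import Data.Integer using (ℤ; +_; _+_; _-_; _*_)
import Data.Integer.Properties as ℤP
open import Algebra.Properties.Semiring.Sum ℤP.+-*-semiring
  using (sum; sum-syntax; sum-cong-≗; sum-replicate-zero; ∑-distrib-+;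
         *-distribˡ-sum; *-distribʳ-sum)
open import Function using (_∘_)
open import Function.Bundles using (_⇔_; Equivalence)
open import Relation.Nullary using (Dec; does; yes; no)
open import Relation.Nullary.Decidable using (_×-dec_)
open import Relation.Unary using (Pred; Decidable)
open import Relation.Binary.PropositionalEquality
  using (_≡_; _≢_; refl; sym; trans; cong; cong₂; subst; module ≡-Reasoning)
open import Data.Product using (Σ; _×_; _,_; proj₁; proj₂)
open import Data.Empty using (⊥-elim)
open import Level using (0ℓ)
open import Data.Integer.Tactic.RingSolver using (solve-∀)

open ≡-Reasoning

private variable
  n : ℕ
  X : Set

𝟙 : Bool → ℤ
𝟙 true  = + 1
𝟙 false = + 0

𝟙-∧ : ∀ a b → 𝟙 (a ∧ b) ≡ 𝟙 a * 𝟙 b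
𝟙-∧ true  true  = refl
𝟙-∧ true  false = refl
𝟙-∧ false b     = refl

𝟙-idem : ∀ a → 𝟙 a * 𝟙 a ≡ 𝟙 a
𝟙-idem true  = refl
𝟙-idem false = refl

χ : Subset n → Fin n → ℤ
χ p x = 𝟙 (lookup p x)

δ : Fin n → Fin n → ℤ
δ x y = 𝟙 (does (x ≟ y))

χ-∈ : {x : Fin n} {p : Subset n} → x ∈ p → χ p x ≡ + 1
χ-∈ x∈p = cong 𝟙 ([]=⇒lookup x∈p)

∈?-lookup : (x : Fin n) (p : Subset n) → does (x ∈? p) ≡ lookup p x
∈?-lookup zero    (true ∷ᵛ p)  = refl
∈?-lookup zero    (false ∷ᵛ p) = refl
∈?-lookup (suc x) (_ ∷ᵛ p)     = ∈?-lookup x p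

mass : Subset n → (Fin n → ℤ) → ℤ
mass {n} D a = ∑[ x < n ] (χ D x * a x)

#_ : Subset n → ℤ
# p = + ∣ p ∣

∑-product : ∀ {m} (f : Fin m → ℤ) (g : Fin n → ℤ) →
  sum f * sum g ≡ ∑[ x < m ] ∑[ y < n ] (f x * g y)
∑-product f g = trans (*-distribʳ-sum (sum g) f) (sum-cong-≗ λ x → *-distribˡ-sum (f x) g)

∑-δ : (x : Fin n) (f : Fin n → ℤ) → ∑[ y < n ] (δ x y * f y) ≡ f x
∑-δ {n = suc n} zero f = begin
  + 1 * f zero + ∑[ y < n ] (+ 0 * f (suc y)) ≡⟨ cong₂ _+_ (ℤP.*-identityˡ (f zero)) (sum-replicate-zero n) ⟩
  f zero + + 0                                ≡⟨ ℤP.+-identityʳ _ ⟩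
  f zero                                      ∎
∑-δ (suc x) f = trans (ℤP.+-identityˡ _) (∑-δ x (f ∘ suc))

∑∑-kernel : (M c : ℤ) (a b : Fin n → ℤ) →
  ∑[ x < n ] ∑[ y < n ] ((M + δ x y * c) * (a x * b y))
    ≡ M * (sum a * sum b) + c * ∑[ x < n ] (a x * b x)
∑∑-kernel {n} M c a b = begin
  ∑[ x < n ] ∑[ y < n ] ((M + δ x y * c) * (a x * b y))
    ≡⟨ sum-cong-≗ (λ x → sum-cong-≗ λ y → expand M c (δ x y) (a x * b y)) ⟩
  ∑[ x < n ] ∑[ y < n ] (M * (a x * b y) + c * (δ x y * (a x * b y)))
    ≡⟨ sum-cong-≗ (λ x → ∑-distrib-+ (λ y → M * (a x * b y)) (λ y → c * (δ x y * (a x * b y)))) ⟩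
  ∑[ x < n ] (∑[ y < n ] (M * (a x * b y)) + ∑[ y < n ] (c * (δ x y * (a x * b y))))
    ≡⟨ sum-cong-≗ (λ x → cong₂ _+_ (*-distribˡ-sum M (λ y → a x * b y))
                                    (*-distribˡ-sum c (λ y → δ x y * (a x * b y)))) ⟨
  ∑[ x < n ] (M * ∑[ y < n ] (a x * b y) + c * ∑[ y < n ] (δ x y * (a x * b y)))
    ≡⟨ sum-cong-≗ (λ x → cong (λ t → M * ∑[ y < n ] (a x * b y) + c * t) (∑-δ x (λ y → a x * b y))) ⟩
  ∑[ x < n ] (M * ∑[ y < n ] (a x * b y) + c * (a x * b x))
    ≡⟨ ∑-distrib-+ (λ x → M * ∑[ y < n ] (a x * b y)) (λ x → c * (a x * b x)) ⟩
  ∑[ x < n ] (M * ∑[ y < n ] (a x * b y)) + ∑[ x < n ] (c * (a x * b x))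
    ≡⟨ cong₂ _+_ (*-distribˡ-sum M (λ x → ∑[ y < n ] (a x * b y))) (*-distribˡ-sum c (λ x → a x * b x)) ⟨
  M * ∑[ x < n ] ∑[ y < n ] (a x * b y) + c * ∑[ x < n ] (a x * b x)
    ≡⟨ cong (λ t → M * t + c * ∑[ x < n ] (a x * b x)) (∑-product a b) ⟨
  M * (sum a * sum b) + c * ∑[ x < n ] (a x * b x) ∎
  where
  expand : ∀ M c d t → (M + d * c) * t ≡ M * t + c * (d * t)
  expand = solve-∀

card : (p : Subset n) → # p ≡ ∑[ x < n ] χ p x
card []ᵛ          = refl
card (true ∷ᵛ p)  = cong (_+_ (+ 1)) (card p)
card (false ∷ᵛ p) = trans (card p) (sym (ℤP.+-identityˡ _))

card-∩ : (p q : Subset n) → # (p ∩ q) ≡ mass p (χ q)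
card-∩ p q = trans (card (p ∩ q))
  (sum-cong-≗ λ x → trans (cong 𝟙 (lookup-zipWith _∧_ x p q)) (𝟙-∧ (lookup p x) (lookup q x)))

sumℤ-cong∈ : {f g : X → ℤ} (xs : List X) → (∀ a → a ∈ₗ xs → f a ≡ g a) →
  sumℤ f xs ≡ sumℤ g xs
sumℤ-cong∈ []       e = refl
sumℤ-cong∈ (a ∷ xs) e = cong₂ _+_ (e a (here refl)) (sumℤ-cong∈ xs λ b b∈ → e b (there b∈))

sumℤ-*ʳ : (c : ℤ) (f : X → ℤ) (xs : List X) → sumℤ (λ a → f a * c) xs ≡ sumℤ f xs * c
sumℤ-*ʳ c f []       = refl
sumℤ-*ʳ c f (a ∷ xs) =
  trans (cong (_+_ (f a * c)) (sumℤ-*ʳ c f xs)) (sym (ℤP.*-distribʳ-+ c (f a) (sumℤ f xs)))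

sumℤ-∑ : (g : X → Fin n → ℤ) (xs : List X) →
  sumℤ (λ a → ∑[ x < n ] g a x) xs ≡ ∑[ x < n ] sumℤ (λ a → g a x) xs
sumℤ-∑ {n = n} g []       = sym (sum-replicate-zero n)
sumℤ-∑         g (a ∷ xs) = trans (cong (_+_ (sum (g a))) (sumℤ-∑ g xs)) (sym (∑-distrib-+ (g a) _))

length-filter : {P : Pred X 0ℓ} (P? : Decidable P) (f : X → ℤ) (xs : List X) →
  (∀ a → a ∈ₗ xs → 𝟙 (does (P? a)) ≡ f a) → + length (filter P? xs) ≡ sumℤ f xs
length-filter P? f []       e = refl
length-filter P? f (a ∷ xs) e with does (P? a) | e a (here refl)
... | true  | fa = cong₂ _+_ fa (length-filter P? f xs λ b b∈ → e b (there b∈))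
... | false | fa = begin
  + length (filter P? xs) ≡⟨ length-filter P? f xs (λ b b∈ → e b (there b∈)) ⟩
  sumℤ f xs               ≡⟨ ℤP.+-identityˡ _ ⟨
  + 0 + sumℤ f xs         ≡⟨ cong (_+ sumℤ f xs) fa ⟩
  f a + sumℤ f xs         ∎

deg : List (Subset n) → Fin n → ℤ
deg 𝒳 x = sumℤ (λ D → χ D x) 𝒳

codeg : List (Subset n) → Fin n → Fin n → ℤ
codeg 𝒳 x y = sumℤ (λ D → χ D x * χ D y) 𝒳

double-count₁ : (𝒳 : List (Subset n)) (a : Fin n → ℤ) →
  sumℤ (λ D → mass D a) 𝒳 ≡ ∑[ x < n ] (deg 𝒳 x * a x)
double-count₁ 𝒳 a =
  trans (sumℤ-∑ (λ D x → χ D x * a x) 𝒳) (sum-cong-≗ λ x → sumℤ-*ʳ (a x) (λ D → χ D x) 𝒳)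

double-count₂ : (𝒳 : List (Subset n)) (a b : Fin n → ℤ) →
  sumℤ (λ D → mass D a * mass D b) 𝒳
    ≡ ∑[ x < n ] ∑[ y < n ] (codeg 𝒳 x y * (a x * b y))
double-count₂ {n} 𝒳 a b = begin
  sumℤ (λ D → mass D a * mass D b) 𝒳
    ≡⟨ sumℤ-cong∈ 𝒳 (λ D _ → trans (∑-product (λ x → χ D x * a x) (λ y → χ D y * b y))
         (sum-cong-≗ λ x → sum-cong-≗ λ y → rearrange (χ D x) (a x) (χ D y) (b y))) ⟩
  sumℤ (λ D → ∑[ x < n ] ∑[ y < n ] (χ D x * χ D y * (a x * b y))) 𝒳
    ≡⟨ sumℤ-∑ (λ D x → ∑[ y < n ] (χ D x * χ D y * (a x * b y))) 𝒳 ⟩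
  ∑[ x < n ] sumℤ (λ D → ∑[ y < n ] (χ D x * χ D y * (a x * b y))) 𝒳
    ≡⟨ sum-cong-≗ (λ x → sumℤ-∑ (λ D y → χ D x * χ D y * (a x * b y)) 𝒳) ⟩
  ∑[ x < n ] ∑[ y < n ] sumℤ (λ D → χ D x * χ D y * (a x * b y)) 𝒳
    ≡⟨ sum-cong-≗ (λ x → sum-cong-≗ λ y → sumℤ-*ʳ (a x * b y) (λ D → χ D x * χ D y) 𝒳) ⟩
  ∑[ x < n ] ∑[ y < n ] (codeg 𝒳 x y * (a x * b y)) ∎
  where
  rearrange : ∀ p q r s → (p * q) * (r * s) ≡ (p * r) * (q * s)
  rearrange = solve-∀

module Balanced {n} (𝒳 : List (Subset n)) (L M : ℤ)
  (deg≡L : ∀ x → deg 𝒳 x ≡ L) (codeg≡M : ∀ x y → x ≢ y → codeg 𝒳 x y ≡ M) where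

  codeg≡ : ∀ x y → codeg 𝒳 x y ≡ M + δ x y * (L - M)
  codeg≡ x y with x ≟ y
  ... | yes refl = begin
    codeg 𝒳 x x            ≡⟨ sumℤ-cong∈ 𝒳 (λ D _ → 𝟙-idem (lookup D x)) ⟩
    deg 𝒳 x                ≡⟨ deg≡L x ⟩
    L                      ≡⟨ diagonal L M ⟩
    M + + 1 * (L - M)      ∎
    where
    diagonal : ∀ L M → L ≡ M + + 1 * (L - M)
    diagonal = solve-∀
  ... | no x≢y = begin
    codeg 𝒳 x y            ≡⟨ codeg≡M x y x≢y ⟩
    M                      ≡⟨ ℤP.+-identityʳ M ⟨
    M + + 0                ∎

  count₁ : (P : Subset n) → sumℤ (λ D → # (D ∩ P)) 𝒳 ≡ L * # P
  count₁ P = begin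
    sumℤ (λ D → # (D ∩ P)) 𝒳        ≡⟨ sumℤ-cong∈ 𝒳 (λ D _ → card-∩ D P) ⟩
    sumℤ (λ D → mass D (χ P)) 𝒳     ≡⟨ double-count₁ 𝒳 (χ P) ⟩
    ∑[ x < n ] (deg 𝒳 x * χ P x)    ≡⟨ sum-cong-≗ (λ x → cong (_* χ P x) (deg≡L x)) ⟩
    ∑[ x < n ] (L * χ P x)          ≡⟨ *-distribˡ-sum L (χ P) ⟨
    L * ∑[ x < n ] χ P x            ≡⟨ cong (L *_) (card P) ⟨
    L * # P                         ∎

  count₂ : (P Q : Subset n) →
    sumℤ (λ D → # (D ∩ P) * # (D ∩ Q)) 𝒳 ≡ M * (# P * # Q) + (L - M) * # (P ∩ Q)
  count₂ P Q = begin
    sumℤ (λ D → # (D ∩ P) * # (D ∩ Q)) 𝒳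
      ≡⟨ sumℤ-cong∈ 𝒳 (λ D _ → cong₂ _*_ (card-∩ D P) (card-∩ D Q)) ⟩
    sumℤ (λ D → mass D (χ P) * mass D (χ Q)) 𝒳
      ≡⟨ double-count₂ 𝒳 (χ P) (χ Q) ⟩
    ∑[ x < n ] ∑[ y < n ] (codeg 𝒳 x y * (χ P x * χ Q y))
      ≡⟨ sum-cong-≗ (λ x → sum-cong-≗ λ y → cong (_* (χ P x * χ Q y)) (codeg≡ x y)) ⟩
    ∑[ x < n ] ∑[ y < n ] ((M + δ x y * (L - M)) * (χ P x * χ Q y))
      ≡⟨ ∑∑-kernel M (L - M) (χ P) (χ Q) ⟩
    M * (sum (χ P) * sum (χ Q)) + (L - M) * mass P (χ Q)
      ≡⟨ cong₂ (λ s t → M * (s * t) + (L - M) * mass P (χ Q)) (card P) (card Q) ⟨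
    M * (# P * # Q) + (L - M) * mass P (χ Q)
      ≡⟨ cong (λ t → M * (# P * # Q) + (L - M) * t) (card-∩ P Q) ⟨
    M * (# P * # Q) + (L - M) * # (P ∩ Q) ∎

  -- The replication relation (v' - 1) L = M (n - 1) when all members have
  -- v' points: the moments above for P = {x} and Q = the whole point set.
  replication : (v' : ℕ) → (∀ D → D ∈ₗ 𝒳 → ∣ D ∣ ≡ v') → Fin n →
    (+ v' - + 1) * L ≡ M * (+ n - + 1)
  replication v' size x = begin
    (+ v' - + 1) * L                           ≡⟨ shift L (+ v') ⟩
    L * + v' - L                               ≡⟨ cong (_- L) (trans (sym count-by-size) count-by-pairs) ⟩
    M * (+ 1 * + n) + (L - M) * + 1 - L        ≡⟨ collect L M (+ n) ⟩
    M * (+ n - + 1)                            ∎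
    where
    #⁅x⁆ : # ⁅ x ⁆ ≡ + 1
    #⁅x⁆ = cong +_ (∣⁅x⁆∣≡1 x)

    count-by-size : sumℤ (λ D → # (D ∩ ⁅ x ⁆) * # (D ∩ ⊤ {n})) 𝒳 ≡ L * + v'
    count-by-size = begin
      sumℤ (λ D → # (D ∩ ⁅ x ⁆) * # (D ∩ ⊤ {n})) 𝒳
        ≡⟨ sumℤ-cong∈ 𝒳 (λ D D∈ → cong (λ t → # (D ∩ ⁅ x ⁆) * + t)
             (trans (cong ∣_∣ (∩-identityʳ D)) (size D D∈))) ⟩
      sumℤ (λ D → # (D ∩ ⁅ x ⁆) * + v') 𝒳 ≡⟨ sumℤ-*ʳ (+ v') _ 𝒳 ⟩
      sumℤ (λ D → # (D ∩ ⁅ x ⁆)) 𝒳 * + v' ≡⟨ cong (_* + v') (count₁ ⁅ x ⁆) ⟩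
      L * # ⁅ x ⁆ * + v'                    ≡⟨ cong (λ t → L * t * + v') #⁅x⁆ ⟩
      L * + 1 * + v'                        ≡⟨ cong (_* + v') (ℤP.*-identityʳ L) ⟩
      L * + v'                              ∎

    count-by-pairs : sumℤ (λ D → # (D ∩ ⁅ x ⁆) * # (D ∩ ⊤ {n})) 𝒳 ≡ M * (+ 1 * + n) + (L - M) * + 1
    count-by-pairs = begin
      sumℤ (λ D → # (D ∩ ⁅ x ⁆) * # (D ∩ ⊤ {n})) 𝒳
        ≡⟨ count₂ ⁅ x ⁆ (⊤ {n}) ⟩
      M * (# ⁅ x ⁆ * # ⊤ {n}) + (L - M) * # (⁅ x ⁆ ∩ ⊤ {n})
        ≡⟨ cong (λ t → M * (# ⁅ x ⁆ * # ⊤ {n}) + (L - M) * + ∣ t ∣) (∩-identityʳ ⁅ x ⁆) ⟩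
      M * (# ⁅ x ⁆ * # ⊤ {n}) + (L - M) * # ⁅ x ⁆
        ≡⟨ cong₂ (λ s t → M * (s * t) + (L - M) * s) #⁅x⁆ (cong +_ (∣⊤∣≡n n)) ⟩
      M * (+ 1 * + n) + (L - M) * + 1 ∎

    shift : ∀ L V' → (V' - + 1) * L ≡ L * V' - L
    shift = solve-∀
    collect : ∀ L M N → M * (+ 1 * N) + (L - M) * + 1 - L ≡ M * (N - + 1)
    collect = solve-∀

filter-≟-unique : {xs : List (Subset n)} {a : Subset n} → Unique xs → a ∈ₗ xs →
  filter (_≟ˢ a) xs ≡ a ∷ []
filter-≟-unique {xs = c ∷ xs} {a} (c∉xs ∷ _) (here a≡c) = begin
  filter (_≟ˢ a) (c ∷ xs) ≡⟨ LP.filter-accept (_≟ˢ a) (sym a≡c) ⟩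
  c ∷ filter (_≟ˢ a) xs   ≡⟨ cong₂ _∷_ (sym a≡c) (LP.filter-none (_≟ˢ a) (All.map a-absent c∉xs)) ⟩
  a ∷ []                  ∎
  where
  a-absent : ∀ {d} → c ≢ d → d ≢ a
  a-absent c≢d d≡a = c≢d (trans (sym a≡c) (sym d≡a))
filter-≟-unique {xs = c ∷ xs} {a} (c∉xs ∷ u) (there a∈) =
  trans (LP.filter-reject (_≟ˢ a) (All.lookup c∉xs a∈)) (filter-≟-unique u a∈)

copies : (f : Subset n → ℤ) (a : Subset n) → List (Subset n) → ℤ
copies f a xs = sumℤ f (filter (_≟ˢ a) xs)

others : (f : Subset n → ℤ) (a b : Subset n) → List (Subset n) → ℤ
others f a b xs = sumℤ f (without₂ xs a b)

sum-split₂ : {a b : Subset n} → a ≢ b → (f : Subset n → ℤ) (xs : List (Subset n)) →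
  sumℤ f xs ≡ copies f a xs + copies f b xs + others f a b xs
sum-split₂ a≢b f [] = refl
sum-split₂ {a = a} {b} a≢b f (c ∷ xs) with c ≟ˢ a | c ≟ˢ b
... | yes refl | yes refl = ⊥-elim (a≢b refl)
... | yes _    | no _     = trans (cong (_+_ (f c)) (sum-split₂ a≢b f xs))
                              (into-first (f c) (copies f a xs) (copies f b xs) (others f a b xs))
  where
  into-first : ∀ x s t w → x + (s + t + w) ≡ x + s + t + w
  into-first = solve-∀
... | no _     | yes _    = trans (cong (_+_ (f c)) (sum-split₂ a≢b f xs))
                              (into-second (f c) (copies f a xs) (copies f b xs) (others f a b xs))
  where
  into-second : ∀ x s t w → x + (s + t + w) ≡ s + (x + t) + w
  into-second = solve-∀
... | no _     | no _     = trans (cong (_+_ (f c)) (sum-split₂ a≢b f xs))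
                              (into-others (f c) (copies f a xs) (copies f b xs) (others f a b xs))
  where
  into-others : ∀ x s t w → x + (s + t + w) ≡ s + t + (x + w)
  into-others = solve-∀

sum-without₂ : {xs : List (Subset n)} {a b : Subset n} →
  Unique xs → a ∈ₗ xs → b ∈ₗ xs → a ≢ b → (f : Subset n → ℤ) →
  sumℤ f xs ≡ f a + f b + others f a b xs
sum-without₂ {xs = xs} {a} {b} u a∈ b∈ a≢b f = begin
  sumℤ f xs
    ≡⟨ sum-split₂ a≢b f xs ⟩
  copies f a xs + copies f b xs + others f a b xs
    ≡⟨ cong₂ (λ s t → sumℤ f s + sumℤ f t + others f a b xs) (filter-≟-unique u a∈) (filter-≟-unique u b∈) ⟩
  (f a + + 0) + (f b + + 0) + others f a b xs
    ≡⟨ cong₂ (λ s t → s + t + others f a b xs) (ℤP.+-identityʳ (f a)) (ℤP.+-identityʳ (f b)) ⟩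
  f a + f b + others f a b xs ∎

∩-─-absorb : (p q : Subset n) → p ∩ (p ─ q) ≡ p ─ q
∩-─-absorb []ᵛ          []ᵛ          = refl
∩-─-absorb (true ∷ᵛ p)  (true ∷ᵛ q)  = cong (false ∷ᵛ_) (∩-─-absorb p q)
∩-─-absorb (true ∷ᵛ p)  (false ∷ᵛ q) = cong (true ∷ᵛ_) (∩-─-absorb p q)
∩-─-absorb (false ∷ᵛ p) (true ∷ᵛ q)  = cong (false ∷ᵛ_) (∩-─-absorb p q)
∩-─-absorb (false ∷ᵛ p) (false ∷ᵛ q) = cong (false ∷ᵛ_) (∩-─-absorb p q)

∩-─-disjoint : (p q : Subset n) → q ∩ (p ─ q) ≡ ⊥
∩-─-disjoint []ᵛ         []ᵛ          = refl
∩-─-disjoint (_ ∷ᵛ p)    (true ∷ᵛ q)  = cong (false ∷ᵛ_) (∩-─-disjoint p q)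
∩-─-disjoint (_ ∷ᵛ p)    (false ∷ᵛ q) = cong (false ∷ᵛ_) (∩-─-disjoint p q)

─-∩-disjoint : (p q : Subset n) → (p ─ q) ∩ (p ∩ q) ≡ ⊥
─-∩-disjoint []ᵛ          []ᵛ          = refl
─-∩-disjoint (true ∷ᵛ p)  (true ∷ᵛ q)  = cong (false ∷ᵛ_) (─-∩-disjoint p q)
─-∩-disjoint (true ∷ᵛ p)  (false ∷ᵛ q) = cong (false ∷ᵛ_) (─-∩-disjoint p q)
─-∩-disjoint (false ∷ᵛ p) (true ∷ᵛ q)  = cong (false ∷ᵛ_) (─-∩-disjoint p q)
─-∩-disjoint (false ∷ᵛ p) (false ∷ᵛ q) = cong (false ∷ᵛ_) (─-∩-disjoint p q)

─-─-disjoint : (p q : Subset n) → (p ─ q) ∩ (q ─ p) ≡ ⊥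
─-─-disjoint []ᵛ          []ᵛ          = refl
─-─-disjoint (true ∷ᵛ p)  (true ∷ᵛ q)  = cong (false ∷ᵛ_) (─-─-disjoint p q)
─-─-disjoint (true ∷ᵛ p)  (false ∷ᵛ q) = cong (false ∷ᵛ_) (─-─-disjoint p q)
─-─-disjoint (false ∷ᵛ p) (true ∷ᵛ q)  = cong (false ∷ᵛ_) (─-─-disjoint p q)
─-─-disjoint (false ∷ᵛ p) (false ∷ᵛ q) = cong (false ∷ᵛ_) (─-─-disjoint p q)

∣p─q∣+∣p∩q∣ : (p q : Subset n) → ∣ p ─ q ∣ ℕ.+ ∣ p ∩ q ∣ ≡ ∣ p ∣
∣p─q∣+∣p∩q∣ []ᵛ          []ᵛ          = refl
∣p─q∣+∣p∩q∣ (true ∷ᵛ p)  (true ∷ᵛ q)  = trans (ℕP.+-suc _ _) (cong suc (∣p─q∣+∣p∩q∣ p q))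
∣p─q∣+∣p∩q∣ (true ∷ᵛ p)  (false ∷ᵛ q) = cong suc (∣p─q∣+∣p∩q∣ p q)
∣p─q∣+∣p∩q∣ (false ∷ᵛ p) (true ∷ᵛ q)  = ∣p─q∣+∣p∩q∣ p q
∣p─q∣+∣p∩q∣ (false ∷ᵛ p) (false ∷ᵛ q) = ∣p─q∣+∣p∩q∣ p q

#─ : (p q : Subset n) → # (p ─ q) ≡ # p - # (p ∩ q)
#─ p q = begin
  # (p ─ q)                              ≡⟨ isolate (# (p ─ q)) (# (p ∩ q)) ⟩
  # (p ─ q) + # (p ∩ q) - # (p ∩ q)      ≡⟨ cong (_- # (p ∩ q)) (ℤP.pos-+ ∣ p ─ q ∣ ∣ p ∩ q ∣) ⟨
  + (∣ p ─ q ∣ ℕ.+ ∣ p ∩ q ∣) - # (p ∩ q) ≡⟨ cong (λ t → + t - # (p ∩ q)) (∣p─q∣+∣p∩q∣ p q) ⟩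
  # p - # (p ∩ q)                        ∎
  where
  isolate : ∀ x y → x ≡ x + y - y
  isolate = solve-∀

#⊥ : {p : Subset n} → p ≡ ⊥ → # p ≡ + 0
#⊥ {n} refl = cong +_ (∣⊥∣≡0 n)

length≡1-member : (xs : List X) → length xs ≡ 1 → Σ X (_∈ₗ xs)
length≡1-member (a ∷ _) _ = a , here refl

length≡1-unique : (xs : List X) → length xs ≡ 1 →
  {a b : X} → a ∈ₗ xs → b ∈ₗ xs → a ≡ b
length≡1-unique (c ∷ []) _ (here a≡c) (here b≡c) = trans a≡c (sym b≡c)

module _ {Bs : List (Subset n)} {x y : Fin n} (one-block : pairCount x y Bs ≡ 1) where

  through? : (B : Subset n) → Dec (x ∈ B × y ∈ B)
  through? B = (x ∈? B) ×-dec (y ∈? B)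

  block-through : Σ (Subset n) λ B → B ∈ₗ Bs × x ∈ B × y ∈ B
  block-through with length≡1-member _ one-block
  ... | B , B∈ = B , ∈ₗ.∈-filter⁻ through? B∈

  block-unique : {B B′ : Subset n} → B ∈ₗ Bs → x ∈ B → y ∈ B →
    B′ ∈ₗ Bs → x ∈ B′ → y ∈ B′ → B ≡ B′
  block-unique B∈ xB yB B′∈ xB′ yB′ = length≡1-unique _ one-block
    (∈ₗ.∈-filter⁺ through? B∈ (xB , yB)) (∈ₗ.∈-filter⁺ through? B′∈ (xB′ , yB′))

-- A sub-design contains the block through any two of its points: the block
-- it uses for them is a block of the design, hence the unique one.
sub-design-closed : ∀ {k} {Bs : List (Subset n)} {W B : Subset n} {x y : Fin n} →
  pairCount x y Bs ≡ 1 → IsSubBIBD k Bs W → x ∈ W → y ∈ W → x ≢ y →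
  B ∈ₗ Bs → x ∈ B → y ∈ B → B ⊆ W
sub-design-closed one-block (Bs′ , Bs′⊆ , _ , _ , pairs′) xW yW x≢y B∈ xB yB
  with block-through (pairs′ _ _ xW yW x≢y)
... | B′ , B′∈Bs′ , xB′ , yB′ with Bs′⊆ B′ B′∈Bs′
...   | B′∈Bs , B′⊆W = subst (_⊆ _) (sym (block-unique one-block B∈ xB yB B′∈Bs xB′ yB′)) B′⊆W

deg≡pointDeg : (𝒳 : List (Subset n)) (x : Fin n) → deg 𝒳 x ≡ + pointDeg 𝒳 x
deg≡pointDeg 𝒳 x = sym (length-filter (x ∈?_) (λ D → χ D x) 𝒳 (λ D _ → cong 𝟙 (∈?-lookup x D)))

codeg≡blockDeg : ∀ {k} {Bs 𝒳 : List (Subset n)} {B : Subset n} {x y : Fin n} →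
  pairCount x y Bs ≡ 1 → (∀ D → D ∈ₗ 𝒳 → IsSubBIBD k Bs D) → x ≢ y →
  B ∈ₗ Bs → x ∈ B → y ∈ B → codeg 𝒳 x y ≡ + blockDeg 𝒳 B
codeg≡blockDeg {𝒳 = 𝒳} {B} {x} {y} one-block sub x≢y B∈ xB yB =
  sym (length-filter (B ⊆?_) (λ D → χ D x * χ D y) 𝒳 contains-block)
  where
  contains-block : ∀ D → D ∈ₗ 𝒳 → 𝟙 (does (B ⊆? D)) ≡ χ D x * χ D y
  contains-block D D∈ with B ⊆? D
  ... | yes B⊆D = sym (cong₂ _*_ (χ-∈ (B⊆D xB)) (χ-∈ (B⊆D yB)))
  ... | no  B⊈D with lookup D x in ex | lookup D y in ey
  ...   | true  | true  = ⊥-elim (B⊈D (sub-design-closed one-block (sub D D∈)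
                            (lookup⇒[]= x D ex) (lookup⇒[]= y D ey) x≢y B∈ xB yB))
  ...   | true  | false = refl
  ...   | false | _     = refl

module Lemma2p9 (v k : ℕ) (Bs : List (Subset v)) (bibd : IsBIBD v k Bs)
  (𝒟 : List (Subset v)) (𝒟-unique : Unique 𝒟)
  (minimal : (W : Subset v) → (W ∈ₗ 𝒟) ⇔ IsMinimalSubBIBD k Bs W)
  (l m : ℕ) (pointDeg≡l : (x : Fin v) → pointDeg 𝒟 x ≡ l)
  (blockDeg≡m : (B : Subset v) → B ∈ₗ Bs → blockDeg 𝒟 B ≡ m)
  (v' : ℕ) (size : (D : Subset v) → D ∈ₗ 𝒟 → ∣ D ∣ ≡ v')
  (D₁ D₂ : Subset v) (D₁∈ : D₁ ∈ₗ 𝒟) (D₂∈ : D₂ ∈ₗ 𝒟) (D₁≢D₂ : D₁ ≢ D₂) where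

  L M V V' I A : ℤ
  L  = + l
  M  = + m
  V  = + v
  V' = + v'
  I  = # (D₁ ∩ D₂)
  A  = V' - I

  P₁ P₂ P₃ : Subset v
  P₁ = D₁ ─ D₂
  P₂ = D₁ ∩ D₂
  P₃ = D₂ ─ D₁

  one-block : ∀ {x y} → x ≢ y → pairCount x y Bs ≡ 1
  one-block x≢y = proj₂ (proj₂ (proj₂ (proj₂ bibd))) _ _ ∈⊤ ∈⊤ x≢y

  sub-designs : ∀ D → D ∈ₗ 𝒟 → IsSubBIBD k Bs D
  sub-designs D D∈ = proj₁ (Equivalence.to (minimal D) D∈)

  codeg≡m : ∀ x y → x ≢ y → codeg 𝒟 x y ≡ M
  codeg≡m x y x≢y with block-through (one-block x≢y)
  ... | B , B∈ , xB , yB =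
    trans (codeg≡blockDeg (one-block x≢y) sub-designs x≢y B∈ xB yB) (cong +_ (blockDeg≡m B B∈))

  open Balanced 𝒟 L M (λ x → trans (deg≡pointDeg 𝒟 x) (cong +_ (pointDeg≡l x))) codeg≡m

  -- (v' - 1) l = m (v - 1), evaluated at any point (there is one, as k < v).
  replication-𝒟 : (V' - + 1) * L ≡ M * (V - + 1)
  replication-𝒟 = replication v' size (fromℕ< (proj₁ (proj₂ bibd)))

  S : (Subset v → ℤ) → ℤ
  S f = sumℤ f (without₂ 𝒟 D₁ D₂)

  S≡ : ∀ f → S f ≡ sumℤ f 𝒟 - f D₁ - f D₂
  S≡ f = trans (isolate (f D₁) (f D₂) (S f))
    (cong (λ t → t - f D₁ - f D₂) (sym (sum-without₂ 𝒟-unique D₁∈ D₂∈ D₁≢D₂ f)))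
    where
    isolate : ∀ x y w → w ≡ x + y + w - x - y
    isolate = solve-∀

  first-moment : ∀ P {p p₁ p₂} → # P ≡ p → # (D₁ ∩ P) ≡ p₁ → # (D₂ ∩ P) ≡ p₂ →
    (V' - + 1) * S (λ D → # (D ∩ P)) ≡ p * (M * (V - + 1)) - (V' - + 1) * (p₁ + p₂)
  first-moment P refl refl refl = begin
    (V' - + 1) * S (λ D → # (D ∩ P))
      ≡⟨ cong ((V' - + 1) *_) (trans (S≡ _) (cong (λ t → t - # (D₁ ∩ P) - # (D₂ ∩ P)) (count₁ P))) ⟩
    (V' - + 1) * (L * # P - # (D₁ ∩ P) - # (D₂ ∩ P))
      ≡⟨ regroup (V' - + 1) L (# P) (# (D₁ ∩ P)) (# (D₂ ∩ P)) ⟩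
    # P * ((V' - + 1) * L) - (V' - + 1) * (# (D₁ ∩ P) + # (D₂ ∩ P))
      ≡⟨ cong (λ t → # P * t - (V' - + 1) * (# (D₁ ∩ P) + # (D₂ ∩ P))) replication-𝒟 ⟩
    # P * (M * (V - + 1)) - (V' - + 1) * (# (D₁ ∩ P) + # (D₂ ∩ P)) ∎
    where
    regroup : ∀ c L p p₁ p₂ → c * (L * p - p₁ - p₂) ≡ p * (c * L) - c * (p₁ + p₂)
    regroup = solve-∀

  second-moment : ∀ P Q {p q p₁ q₁ p₂ q₂ r} → # P ≡ p → # Q ≡ q →
    # (D₁ ∩ P) ≡ p₁ → # (D₁ ∩ Q) ≡ q₁ → # (D₂ ∩ P) ≡ p₂ → # (D₂ ∩ Q) ≡ q₂ → # (P ∩ Q) ≡ r →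
    S (λ D → # (D ∩ P) * # (D ∩ Q)) ≡ M * (p * q) + (L - M) * r - p₁ * q₁ - p₂ * q₂
  second-moment P Q refl refl refl refl refl refl refl =
    trans (S≡ _) (cong (λ t → t - # (D₁ ∩ P) * # (D₁ ∩ Q) - # (D₂ ∩ P) * # (D₂ ∩ Q)) (count₂ P Q))

  -- On the diagonal, L is eliminated by the replication relation.
  second-moment-diagonal : ∀ P {p p₁ p₂} → # P ≡ p → # (D₁ ∩ P) ≡ p₁ → # (D₂ ∩ P) ≡ p₂ →
    (V' - + 1) * S (λ D → # (D ∩ P) * # (D ∩ P))
      ≡ p * (M * (V - + 1)) + (V' - + 1) * (M * (p * p) - M * p - p₁ * p₁ - p₂ * p₂)
  second-moment-diagonal P {p} {p₁} {p₂} e e₁ e₂ = begin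
    (V' - + 1) * S (λ D → # (D ∩ P) * # (D ∩ P))
      ≡⟨ cong ((V' - + 1) *_) (second-moment P P e e e₁ e₁ e₂ e₂ (trans (cong #_ (∩-idem P)) e)) ⟩
    (V' - + 1) * (M * (p * p) + (L - M) * p - p₁ * p₁ - p₂ * p₂)
      ≡⟨ regroup (V' - + 1) L M p p₁ p₂ ⟩
    p * ((V' - + 1) * L) + (V' - + 1) * (M * (p * p) - M * p - p₁ * p₁ - p₂ * p₂)
      ≡⟨ cong (λ t → p * t + (V' - + 1) * (M * (p * p) - M * p - p₁ * p₁ - p₂ * p₂)) replication-𝒟 ⟩
    p * (M * (V - + 1)) + (V' - + 1) * (M * (p * p) - M * p - p₁ * p₁ - p₂ * p₂) ∎
    where
    regroup : ∀ c L M p p₁ p₂ → c * (M * (p * p) + (L - M) * p - p₁ * p₁ - p₂ * p₂)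
                              ≡ p * (c * L) + c * (M * (p * p) - M * p - p₁ * p₁ - p₂ * p₂)
    regroup = solve-∀

  #P₁ : # P₁ ≡ A
  #P₁ = trans (#─ D₁ D₂) (cong (_- I) (cong +_ (size D₁ D₁∈)))

  #P₃ : # P₃ ≡ A
  #P₃ = trans (#─ D₂ D₁) (cong₂ _-_ (cong +_ (size D₂ D₂∈)) (cong #_ (∩-comm D₂ D₁)))

  #D₁∩P₁ : # (D₁ ∩ P₁) ≡ A
  #D₁∩P₁ = trans (cong #_ (∩-─-absorb D₁ D₂)) #P₁

  #D₂∩P₃ : # (D₂ ∩ P₃) ≡ A
  #D₂∩P₃ = trans (cong #_ (∩-─-absorb D₂ D₁)) #P₃

  #D₂∩P₁ : # (D₂ ∩ P₁) ≡ + 0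
  #D₂∩P₁ = #⊥ (∩-─-disjoint D₁ D₂)

  #D₁∩P₃ : # (D₁ ∩ P₃) ≡ + 0
  #D₁∩P₃ = #⊥ (∩-─-disjoint D₂ D₁)

  #D₁∩P₂ : # (D₁ ∩ P₂) ≡ I
  #D₁∩P₂ = cong #_ (trans (sym (∩-assoc D₁ D₁ D₂)) (cong (_∩ D₂) (∩-idem D₁)))

  #D₂∩P₂ : # (D₂ ∩ P₂) ≡ I
  #D₂∩P₂ = cong #_ (trans (∩-comm D₂ P₂) (trans (∩-assoc D₁ D₂ D₂) (cong (D₁ ∩_) (∩-idem D₂))))

  #P₁∩P₂ : # (P₁ ∩ P₂) ≡ + 0
  #P₁∩P₂ = #⊥ (─-∩-disjoint D₁ D₂)

  #P₂∩P₃ : # (P₂ ∩ P₃) ≡ + 0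
  #P₂∩P₃ = #⊥ (trans (∩-comm P₂ P₃) (trans (cong (P₃ ∩_) (∩-comm D₁ D₂)) (─-∩-disjoint D₂ D₁)))

  #P₁∩P₃ : # (P₁ ∩ P₃) ≡ + 0
  #P₁∩P₃ = #⊥ (─-─-disjoint D₁ D₂)

  sum-i₁ : (V' - + 1) * S (λ D → # (D ∩ P₁)) ≡ A * (M * (V - + 1) - (V' - + 1))
  sum-i₁ = trans (first-moment P₁ #P₁ #D₁∩P₁ #D₂∩P₁) (ring A (M * (V - + 1)) (V' - + 1))
    where
    ring : ∀ a X c → a * X - c * (a + + 0) ≡ a * (X - c)
    ring = solve-∀

  sum-i₃ : (V' - + 1) * S (λ D → # (D ∩ P₃)) ≡ A * (M * (V - + 1) - (V' - + 1))
  sum-i₃ = trans (first-moment P₃ #P₃ #D₁∩P₃ #D₂∩P₃) (ring A (M * (V - + 1)) (V' - + 1))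
    where
    ring : ∀ a X c → a * X - c * (+ 0 + a) ≡ a * (X - c)
    ring = solve-∀

  sum-i₂ : (V' - + 1) * S (λ D → # (D ∩ P₂)) ≡ I * (M * (V - + 1) - + 2 * (V' - + 1))
  sum-i₂ = trans (first-moment P₂ refl #D₁∩P₂ #D₂∩P₂) (ring I (M * (V - + 1)) (V' - + 1))
    where
    ring : ∀ i X c → i * X - c * (i + i) ≡ i * (X - + 2 * c)
    ring = solve-∀

  sum-i₁² : (V' - + 1) * S (λ D → # (D ∩ P₁) * # (D ∩ P₁))
    ≡ A * (M * ((V - + 1) + (A - + 1) * (V' - + 1)) - A * (V' - + 1))
  sum-i₁² = trans (second-moment-diagonal P₁ #P₁ #D₁∩P₁ #D₂∩P₁) (ring A M (V - + 1) (V' - + 1))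
    where
    ring : ∀ a M X c → a * (M * X) + c * (M * (a * a) - M * a - a * a - + 0 * + 0)
                       ≡ a * (M * (X + (a - + 1) * c) - a * c)
    ring = solve-∀

  sum-i₃² : (V' - + 1) * S (λ D → # (D ∩ P₃) * # (D ∩ P₃))
    ≡ A * (M * ((V - + 1) + (A - + 1) * (V' - + 1)) - A * (V' - + 1))
  sum-i₃² = trans (second-moment-diagonal P₃ #P₃ #D₁∩P₃ #D₂∩P₃) (ring A M (V - + 1) (V' - + 1))
    where
    ring : ∀ a M X c → a * (M * X) + c * (M * (a * a) - M * a - + 0 * + 0 - a * a)
                       ≡ a * (M * (X + (a - + 1) * c) - a * c)
    ring = solve-∀

  sum-i₁i₂ : S (λ D → # (D ∩ P₁) * # (D ∩ P₂)) ≡ I * A * (M - + 1)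
  sum-i₁i₂ = trans (second-moment P₁ P₂ #P₁ refl #D₁∩P₁ #D₁∩P₂ #D₂∩P₁ #D₂∩P₂ #P₁∩P₂) (ring A I L M)
    where
    ring : ∀ a i L M → M * (a * i) + (L - M) * + 0 - a * i - + 0 * i ≡ i * a * (M - + 1)
    ring = solve-∀

  sum-i₂i₃ : S (λ D → # (D ∩ P₂) * # (D ∩ P₃)) ≡ I * A * (M - + 1)
  sum-i₂i₃ = trans (second-moment P₂ P₃ refl #P₃ #D₁∩P₂ #D₁∩P₃ #D₂∩P₂ #D₂∩P₃ #P₂∩P₃) (ring A I L M)
    where
    ring : ∀ a i L M → M * (i * a) + (L - M) * + 0 - i * + 0 - i * a ≡ i * a * (M - + 1)
    ring = solve-∀

  sum-i₁i₃ : S (λ D → # (D ∩ P₁) * # (D ∩ P₃)) ≡ A * A * M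
  sum-i₁i₃ = trans (second-moment P₁ P₃ #P₁ #P₃ #D₁∩P₁ #D₁∩P₃ #D₂∩P₁ #D₂∩P₃ #P₁∩P₃) (ring A L M)
    where
    ring : ∀ a L M → M * (a * a) + (L - M) * + 0 - a * + 0 - + 0 * a ≡ a * a * M
    ring = solve-∀

lemma2p9 : (v k : ℕ) (Bs : List (Subset v)) → IsBIBD v k Bs →
  (𝒟 : List (Subset v)) → Unique 𝒟 →
  ((W : Subset v) → (W ∈ₗ 𝒟) ⇔ IsMinimalSubBIBD k Bs W) →
  (l m : ℕ) → ((x : Fin v) → pointDeg 𝒟 x ≡ l) →
  ((B : Subset v) → B ∈ₗ Bs → blockDeg 𝒟 B ≡ m) →
  (v' : ℕ) → ((D : Subset v) → D ∈ₗ 𝒟 → ∣ D ∣ ≡ v') →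
  (D₁ D₂ : Subset v) → D₁ ∈ₗ 𝒟 → D₂ ∈ₗ 𝒟 → D₁ ≢ D₂ →
  let i = + ∣ D₁ ∩ D₂ ∣
      V = + v
      V' = + v'
      M = + m
      𝒟' = without₂ 𝒟 D₁ D₂
      i₁ = λ (D : Subset v) → + ∣ D ∩ (D₁ ─ D₂) ∣
      i₂ = λ (D : Subset v) → + ∣ D ∩ D₁ ∩ D₂ ∣
      i₃ = λ (D : Subset v) → + ∣ D ∩ (D₂ ─ D₁) ∣
      S = λ (f : Subset v → ℤ) → sumℤ f 𝒟'
  in
  ((V' - + 1) * S i₁ ≡ (V' - i) * (M * (V - + 1) - (V' - + 1))) ×
  ((V' - + 1) * S i₃ ≡ (V' - i) * (M * (V - + 1) - (V' - + 1))) ×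
  ((V' - + 1) * S (λ D → i₁ D * i₁ D)
    ≡ (V' - i) * (M * ((V - + 1) + (V' - i - + 1) * (V' - + 1)) - (V' - i) * (V' - + 1))) ×
  ((V' - + 1) * S (λ D → i₃ D * i₃ D)
    ≡ (V' - i) * (M * ((V - + 1) + (V' - i - + 1) * (V' - + 1)) - (V' - i) * (V' - + 1))) ×
  ((V' - + 1) * S i₂ ≡ i * (M * (V - + 1) - + 2 * (V' - + 1))) ×
  (S (λ D → i₁ D * i₂ D) ≡ i * (V' - i) * (M - + 1)) ×
  (S (λ D → i₂ D * i₃ D) ≡ i * (V' - i) * (M - + 1)) ×
  (S (λ D → i₁ D * i₃ D) ≡ (V' - i) * (V' - i) * M)
lemma2p9 v k Bs bibd 𝒟 𝒟-unique minimal l m pointDeg≡l blockDeg≡m v' size D₁ D₂ D₁∈ D₂∈ D₁≢D₂ =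
  sum-i₁ , sum-i₃ , sum-i₁² , sum-i₃² , sum-i₂ , sum-i₁i₂ , sum-i₂i₃ , sum-i₁i₃
  where
  open Lemma2p9 v k Bs bibd 𝒟 𝒟-unique minimal l m pointDeg≡l blockDeg≡m v' size D₁ D₂ D₁∈ D₂∈ D₁≢D₂
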